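{- Let $F\colon\mathbb{B}^{2L}\to\mathbb{B}^{2L}$ be the Boolean Delta-Notch system over a graph $\mathcal{G}$ as in the context, let $x\in\mathbb{B}^{2L}$ be a fixed point of $F$, and let $I=I_N\cup(I_D+L)$ with $I_N,I_D\subseteq C$. Then the subspace $x[I]$ is a trap space for $F$ if and only if all of the following hold: the subspace $x[I_N\cup(I_N+L)]$ is a trap space for $F$; $I_N\subseteq I_D$; (i) $S(I_D\setminus I_N)\cap I_D=\emptyset$ and $x_j=0$ for all $j\in I_D\setminus I_N$; and (ii) for every $i\in S(I_D\setminus I_N)$ there exists $j\in S(i)\cap(C\setminus I_D)$ such that $x_j=0$.
   Context: Let $L\ge 1$ and let $\mathcal{G}$ be an undirected connected graph without loops on the vertex set $C=\{1,\dots,L\}$. For $i\in C$ let $S(i)$ be the set of neighbours of $i$ in $\mathcal{G}$, and for $A\subseteq C$ let $S(A)=\bigcup_{i\in A}S(i)$; for $J\subseteq C$, $J+L=\{j+L: j\in J\}$. $\mathbb{B}=\{0,1\}$. States of $\mathbb{B}^{2L}$ are written $x=(n,d)=(n_1,\dots,n_L,d_1,\dots,d_L)$, so $x_i=n_i$ and $x_{i+L}=d_i$. The Boolean Delta-Notch system is $F\colon\mathbb{B}^{2L}\to\mathbb{B}^{2L}$ with $F_i(n,d)=\bigvee_{j\in S(i)}d_j$ (empty disjunction $=0$) and $F_{i+L}(n,d)=1-n_i$ for $i\in C$. The asynchronous dynamics $AD_F$ has an edge from $x$ to the state obtained by flipping coordinate $i$ whenever $F_i(x)\neq x_i$. For $I\subseteq\{1,\dots,2L\}$,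 the subspace $x[I]$ is $\{y: y_i=x_i \ \forall i\notin I\}$. A trap space is a subspace $A$ such that every successor in $AD_F$ of a state in $A$ lies in $A$. -}

module Defs where

open import Data.Nat using (ℕ; _≥_)
open import Data.Fin using (Fin)
open import Data.Fin.Subset using (Subset; _∈_; _∉_)
open import Data.Bool using (Bool; true; false; not; _∧_; _∨_)
open import Data.Vec using (tabulate)
open import Data.Sum using (_⊎_; inj₁; inj₂)
open import Data.Product using (Σ; _×_; ∃; ∃-syntax)
open import Relation.Binary.PropositionalEquality using (_≡_; _≢_)
open import Relation.Nullary using (¬_)

⋁ : ∀ {L} → (Fin L → Bool) → Bool
⋁ f = Data.Vec.foldr _ _∨_ false (tabulate f)

Adj' : ∀ {L} → (Fin L → Fin L → Bool) → Fin L → Fin L → Set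
Adj' adj i j = adj i j ≡ true

data Reach {L} (adj : Fin L → Fin L → Bool) : Fin L → Fin L → Set where
  here : ∀ {i} → Reach adj i i
  step : ∀ {i j k} → adj i j ≡ true → Reach adj j k → Reach adj i k

record Graph (L : ℕ) : Set where
  field
    adj       : Fin L → Fin L → Bool
    symmetric : ∀ i j → adj i j ≡ adj j i
    loopless  : ∀ i → adj i i ≡ false
    connected : ∀ i j → Reach adj i j

open Graph public

Adj : ∀ {L} → Graph L → Fin L → Fin L → Set
Adj G i j = adj G i j ≡ true

-- Coordinates {1,…,2L}: inj₁ i is coordinate i (n_i), inj₂ i is coordinate i+L (d_i).
Idx : ℕ → Set
Idx L = Fin L ⊎ Fin L

State : ℕ → Set
State L = Idx L → Bool

F : ∀ {L} → Graph L → State L → State L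
F G x (inj₁ i) = ⋁ (λ j → adj G i j ∧ x (inj₂ j))
F G x (inj₂ i) = not (x (inj₁ i))

FixedPoint : ∀ {L} → Graph L → State L → Set
FixedPoint G x = ∀ k → F G x k ≡ x k

flipAt : ∀ {L} → State L → Idx L → State L
flipAt x (inj₁ i) (inj₁ j) with i Data.Fin.≟ j
... | Relation.Nullary.yes _ = not (x (inj₁ j))
... | Relation.Nullary.no _ = x (inj₁ j)
flipAt x (inj₁ i) (inj₂ j) = x (inj₂ j)
flipAt x (inj₂ i) (inj₁ j) = x (inj₁ j)
flipAt x (inj₂ i) (inj₂ j) with i Data.Fin.≟ j
... | Relation.Nullary.yes _ = not (x (inj₂ j))
... | Relation.Nullary.no _ = x (inj₂ j)

ADEdge : {L : ℕ} → Graph L → State L → State L → Set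
ADEdge {L} G x y = Σ (Idx L) λ k → (F G x k ≢ x k) × (∀ k' → y k' ≡ flipAt x k k')

Subspace : ∀ {L} → State L → (Idx L → Set) → State L → Set
Subspace x I y = ∀ k → ¬ I k → y k ≡ x k

IsTrapSet : ∀ {L} → Graph L → (State L → Set) → Set
IsTrapSet G A = ∀ y z → A y → ADEdge G y z → A z

TrapSpace : ∀ {L} → Graph L → State L → (Idx L → Set) → Set
TrapSpace G x I = IsTrapSet G (Subspace x I)

combine : ∀ {L} → Subset L → Subset L → Idx L → Set
combine IN ID (inj₁ i) = i ∈ IN
combine IN ID (inj₂ i) = i ∈ ID

InS : ∀ {L} → Graph L → (Fin L → Set) → Fin L → Set
InS G A i = ∃[ j ] (A j × Adj G j i)

-- A subspace x[I] is a trap space exactly when F maps it into itself, and only the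
-- coordinates outside I need checking. At a fixed point, d_k = ¬ n_k, and n_i = 1 as soon
-- as some neighbour k has n_k = 0. Forward: for i ∉ I_N adjacent to I_D, setting all d_j
-- with j ∈ I_D to 1 forces n_i = 1, and setting them to 0 then produces a neighbour
-- k ∉ I_D of i with n_k = 0; this yields (ii). If some j ∈ I_D ∖ I_N had n_j = 1, the same
-- two steps would give a neighbour m ∉ I_D of j with n_m = 0 and yet n_m = 1, which
-- yields (i). Backward: a vertex i ∉ I_N is either covered by (ii), or its neighbours in
-- I_D all lie in I_N, so that moving the free d-coordinates outside I_N back to x does not
-- change F_i.
module Submission where

open import Defs
open import Data.Nat using (ℕ; _≥_; zero; suc)
open import Data.Fin using (Fin; zero; suc; _≟_)
open import Data.Fin.Subset using (Subset; _∈_; _∉_)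
open import Data.Fin.Subset.Properties using (_∈?_)
open import Data.Fin.Properties using (any?)
open import Data.Bool using (Bool; true; false; not; _∧_; _∨_)
open import Data.Bool.Properties using (not-¬; ∨-zeroʳ) renaming (_≟_ to _≟ᵇ_)
open import Data.Sum using (inj₁; inj₂)
open import Data.Sum.Properties using (≡-dec)
open import Data.Product using (_×_; ∃-syntax; _,_)
open import Data.Empty using (⊥-elim)
open import Relation.Unary using (Decidable)
open import Relation.Nullary using (¬_; yes; no; _×-dec_; ¬?)
open import Relation.Binary.PropositionalEquality
  using (_≡_; refl; sym; trans; cong; cong₂; _≢_; module ≡-Reasoning)
open import Function.Bundles using (_⇔_; mk⇔; module Equivalence)

⋁-cong : ∀ {L} {f g : Fin L → Bool} → (∀ j → f j ≡ g j) → ⋁ f ≡ ⋁ g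
⋁-cong {zero}  e = refl
⋁-cong {suc L} e = cong₂ _∨_ (e zero) (⋁-cong (λ j → e (suc j)))

⋁-intro : ∀ {L} (f : Fin L → Bool) j → f j ≡ true → ⋁ f ≡ true
⋁-intro f zero    e rewrite e = refl
⋁-intro f (suc j) e rewrite ⋁-intro (λ j → f (suc j)) j e = ∨-zeroʳ (f zero)

⋁-witness : ∀ {L} (f : Fin L → Bool) → ⋁ f ≡ true → ∃[ j ] f j ≡ true
⋁-witness {suc L} f e with f zero in f₀
... | true  = zero , f₀
... | false with ⋁-witness (λ j → f (suc j)) e
...   | j , fj = suc j , fj

flipAt-self : ∀ {L} (y : State L) k → flipAt y k k ≡ not (y k)
flipAt-self y (inj₁ i) with i ≟ i
... | yes _  = refl
... | no i≢i = ⊥-elim (i≢i refl)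
flipAt-self y (inj₂ i) with i ≟ i
... | yes _  = refl
... | no i≢i = ⊥-elim (i≢i refl)

flipAt-other : ∀ {L} (y : State L) k k' → k ≢ k' → flipAt y k k' ≡ y k'
flipAt-other y (inj₁ i) (inj₁ j) k≢k' with i ≟ j
... | yes refl = ⊥-elim (k≢k' refl)
... | no _     = refl
flipAt-other y (inj₁ i) (inj₂ j) _ = refl
flipAt-other y (inj₂ i) (inj₁ j) _ = refl
flipAt-other y (inj₂ i) (inj₂ j) k≢k' with i ≟ j
... | yes refl = ⊥-elim (k≢k' refl)
... | no _     = refl

module _ {L : ℕ} (x : State L) where

  Subspace-mono : ∀ {I J : Idx L → Set} → (∀ k → I k → J k) →
                  ∀ {y} → Subspace x I y → Subspace x J y
  Subspace-mono I⊆J y∈ k k∉J = y∈ k (λ k∈I → k∉J (I⊆J k k∈I))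

  flipAt-Subspace : ∀ {I : Idx L → Set} {y} k → I k → Subspace x I y → Subspace x I (flipAt y k)
  flipAt-Subspace {y = y} k k∈I y∈ k' k'∉I =
    trans (flipAt-other y k k' (λ { refl → k'∉I k∈I })) (y∈ k' k'∉I)

  project : {I : Idx L → Set} → Decidable I → State L → State L
  project I? y k with I? k
  ... | yes _ = y k
  ... | no _  = x k

  project-∈ : ∀ {I : Idx L → Set} (I? : Decidable I) y k → I k → project I? y k ≡ y k
  project-∈ I? y k k∈I with I? k
  ... | yes _   = refl
  ... | no k∉I  = ⊥-elim (k∉I k∈I)

  project-Subspace : ∀ {I : Idx L → Set} (I? : Decidable I) y → Subspace x I (project I? y)
  project-Subspace I? y k k∉I with I? k
  ... | yes k∈I = ⊥-elim (k∉I k∈I)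
  ... | no _    = refl

combine? : ∀ {L} (IN ID : Subset L) → Decidable (combine IN ID)
combine? IN ID (inj₁ i) = i ∈? IN
combine? IN ID (inj₂ i) = i ∈? ID

module _ {L : ℕ} (G : Graph L) where

  F-Invariant : State L → (Idx L → Set) → Set
  F-Invariant x I = ∀ y → Subspace x I y → Subspace x I (F G y)

  trapSpace⇔F-Invariant : ∀ x I → TrapSpace G x I ⇔ F-Invariant x I
  trapSpace⇔F-Invariant x I = mk⇔ invariant trap
    where
    invariant : TrapSpace G x I → F-Invariant x I
    invariant T y y∈ k k∉I with F G y k ≟ᵇ y k
    ... | yes Fy≡y = trans Fy≡y (y∈ k k∉I)
    ... | no Fy≢y  = ⊥-elim (not-¬ (sym (y∈ k k∉I)) (begin
          x k                ≡⟨ T y (flipAt y k) y∈ (k , Fy≢y , λ _ → refl) k k∉I ⟨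
          flipAt y k k       ≡⟨ flipAt-self y k ⟩
          not (y k)          ∎))
      where open ≡-Reasoning

    trap : F-Invariant x I → TrapSpace G x I
    trap inv y z y∈ (k , Fy≢y , z≡) k' k'∉I with ≡-dec _≟_ _≟_ k k'
    ... | yes refl = ⊥-elim (Fy≢y (trans (inv y y∈ k k'∉I) (sym (y∈ k k'∉I))))
    ... | no k≢k'  = trans (z≡ k') (trans (flipAt-other y k k' k≢k') (y∈ k' k'∉I))

  F-n-true : ∀ y {i k} → Adj G i k → y (inj₂ k) ≡ true → F G y (inj₁ i) ≡ true
  F-n-true y {k = k} a yk = ⋁-intro _ k (cong₂ _∧_ a yk)

  F-n-witness : ∀ y {i} → F G y (inj₁ i) ≡ true → ∃[ k ] (Adj G i k × y (inj₂ k) ≡ true)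
  F-n-witness y {i} Fy with ⋁-witness _ Fy
  ... | k , adj∧d≡1 with adj G i k in a | y (inj₂ k) in yk
  ...   | true | true = k , a , yk

  F-n-cong : ∀ {y z i} → (∀ k → Adj G i k → y (inj₂ k) ≡ z (inj₂ k)) →
             F G y (inj₁ i) ≡ F G z (inj₁ i)
  F-n-cong {y} {z} {i} agree = ⋁-cong pointwise
    where
    pointwise : ∀ k → (adj G i k ∧ y (inj₂ k)) ≡ (adj G i k ∧ z (inj₂ k))
    pointwise k with adj G i k in a
    ... | false = refl
    ... | true  = agree k a

module FixedPointFacts {L : ℕ} (G : Graph L) {x : State L} (fp : FixedPoint G x) where

  d≡not-n : ∀ i → x (inj₂ i) ≡ not (x (inj₁ i))
  d≡not-n i = sym (fp (inj₂ i))

  n-false⇒d-true : ∀ {i} → x (inj₁ i) ≡ false → x (inj₂ i) ≡ true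
  n-false⇒d-true {i} n≡0 = trans (d≡not-n i) (cong not n≡0)

  d-true⇒n-false : ∀ {i} → x (inj₂ i) ≡ true → x (inj₁ i) ≡ false
  d-true⇒n-false {i} d≡1 with x (inj₁ i) | d≡not-n i
  ... | false | _ = refl
  ... | true  | d≡0 = trans (sym d≡1) d≡0

  neighbour-n-false⇒n-true : ∀ {i k} → Adj G i k → x (inj₁ k) ≡ false → x (inj₁ i) ≡ true
  neighbour-n-false⇒n-true {i} a nk≡0 =
    trans (sym (fp (inj₁ i))) (F-n-true G x a (n-false⇒d-true nk≡0))

  d-Invariant : ∀ {I : Idx L → Set} y i → ¬ I (inj₁ i) → Subspace x I y →
                F G y (inj₂ i) ≡ x (inj₂ i)
  d-Invariant y i ni∉I y∈ = trans (cong not (y∈ (inj₁ i) ni∉I)) (fp (inj₂ i))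

  n-true⇒witness : ∀ {i} → x (inj₁ i) ≡ true → ∃[ k ] (Adj G i k × x (inj₂ k) ≡ true)
  n-true⇒witness {i} ni≡1 = F-n-witness G x (trans (fp (inj₁ i)) ni≡1)

module Forward {L : ℕ} (G : Graph L) {x : State L} (fp : FixedPoint G x) (IN ID : Subset L)
               (inv : F-Invariant G x (combine IN ID)) where

  open FixedPointFacts G fp

  saturate : Bool → State L
  saturate b = project x (combine? IN ID) (λ _ → b)

  saturate-F-n : ∀ b {i} → i ∉ IN → F G (saturate b) (inj₁ i) ≡ x (inj₁ i)
  saturate-F-n b i∉IN = inv (saturate b) (project-Subspace x (combine? IN ID) _) (inj₁ _) i∉IN

  n-true-near-ID : ∀ {i j} → i ∉ IN → Adj G i j → j ∈ ID → x (inj₁ i) ≡ true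
  n-true-near-ID i∉IN a j∈ID =
    trans (sym (saturate-F-n true i∉IN))
          (F-n-true G (saturate true) a (project-∈ x (combine? IN ID) (λ _ → true) (inj₂ _) j∈ID))

  escape-ID : ∀ {i j} → i ∉ IN → Adj G i j → j ∈ ID →
              ∃[ k ] (Adj G i k × k ∉ ID × x (inj₁ k) ≡ false)
  escape-ID i∉IN a j∈ID
    with F-n-witness G (saturate false)
           (trans (saturate-F-n false i∉IN) (n-true-near-ID i∉IN a j∈ID))
  ... | k , aik , d≡1 with k ∈? ID
  ...   | yes _   with () ← d≡1
  ...   | no k∉ID = k , aik , k∉ID , d-true⇒n-false d≡1

  IN⊆ID : ∀ i → i ∈ IN → i ∈ ID
  IN⊆ID i i∈IN with i ∈? ID
  ... | yes i∈ID = i∈ID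
  ... | no i∉ID  = ⊥-elim (not-¬ (d≡not-n i) (begin
        x (inj₂ i)                          ≡⟨ inv y y∈ (inj₂ i) i∉ID ⟨
        not (flipAt x (inj₁ i) (inj₁ i))    ≡⟨ cong not (flipAt-self x (inj₁ i)) ⟩
        not (not (x (inj₁ i)))              ∎))
    where
    open ≡-Reasoning
    y : State L
    y = flipAt x (inj₁ i)
    y∈ : Subspace x (combine IN ID) y
    y∈ = flipAt-Subspace x (inj₁ i) i∈IN (λ _ _ → refl)

  invariant-IN : F-Invariant G x (combine IN IN)
  invariant-IN y y∈ (inj₁ i) i∉IN = inv y (Subspace-mono x I₀⊆I y∈) (inj₁ i) i∉IN
    where
    I₀⊆I : ∀ k → combine IN IN k → combine IN ID k
    I₀⊆I (inj₁ l) l∈IN = l∈IN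
    I₀⊆I (inj₂ l) l∈IN = IN⊆ID l l∈IN
  invariant-IN y y∈ (inj₂ i) i∉IN = d-Invariant y i i∉IN y∈

  n-true-outside-ID : ∀ {m j} → m ∉ ID → Adj G m j → j ∈ ID → x (inj₁ m) ≡ true
  n-true-outside-ID {m} m∉ID = n-true-near-ID (λ m∈IN → m∉ID (IN⊆ID m m∈IN))

  zero-neighbour-outside-ID : ∀ {j} → j ∉ IN → ∃[ k ] (Adj G j k × x (inj₂ k) ≡ true) →
                              ∃[ m ] (Adj G j m × m ∉ ID × x (inj₁ m) ≡ false)
  zero-neighbour-outside-ID j∉IN (k , ajk , dk≡1) with k ∈? ID
  ... | yes k∈ID = escape-ID j∉IN ajk k∈ID
  ... | no k∉ID  = k , ajk , k∉ID , d-true⇒n-false dk≡1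

  ID∖IN-n-false : ∀ {j} → j ∈ ID → j ∉ IN → x (inj₁ j) ≡ false
  ID∖IN-n-false {j} j∈ID j∉IN with x (inj₁ j) in nj
  ... | false = refl
  ... | true
    with m , ajm , m∉ID , nm≡0 ← zero-neighbour-outside-ID j∉IN (n-true⇒witness nj)
    with () ← trans (sym (n-true-outside-ID m∉ID (trans (symmetric G m j) ajm) j∈ID)) nm≡0

  ID∖IN-isolated : ∀ {j} → j ∈ ID → j ∉ IN → ∀ i → Adj G j i → i ∉ ID
  ID∖IN-isolated j∈ID j∉IN i a i∈ID
    with () ← trans (sym (n-true-near-ID j∉IN a i∈ID)) (ID∖IN-n-false j∈ID j∉IN)

  escape-ID∖IN : ∀ i → InS G (λ j → j ∈ ID × j ∉ IN) i →
                 ∃[ k ] (Adj G i k × k ∉ ID × x (inj₁ k) ≡ false)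
  escape-ID∖IN i (j , (j∈ID , j∉IN) , aji) with i ∈? IN
  ... | yes i∈IN = ⊥-elim (ID∖IN-isolated j∈ID j∉IN i aji (IN⊆ID i i∈IN))
  ... | no i∉IN  = escape-ID i∉IN (trans (symmetric G i j) aji) j∈ID

module Backward {L : ℕ} (G : Graph L) {x : State L} (fp : FixedPoint G x) (IN ID : Subset L)
                (inv₀ : F-Invariant G x (combine IN IN)) (IN⊆ID : ∀ i → i ∈ IN → i ∈ ID)
                (escape : ∀ i → InS G (λ j → j ∈ ID × j ∉ IN) i →
                            ∃[ k ] (Adj G i k × k ∉ ID × x (inj₁ k) ≡ false)) where

  open FixedPointFacts G fp

  module _ {y : State L} (y∈ : Subspace x (combine IN ID) y) where

    F-n-near-ID∖IN : ∀ {i j} → Adj G i j → j ∈ ID → j ∉ IN → F G y (inj₁ i) ≡ x (inj₁ i)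
    F-n-near-ID∖IN {i} {j} aij j∈ID j∉IN
      with escape i (j , (j∈ID , j∉IN) , trans (symmetric G j i) aij)
    ... | k , aik , k∉ID , nk≡0 =
          trans (F-n-true G y aik (trans (y∈ (inj₂ k) k∉ID) (n-false⇒d-true nk≡0)))
                (sym (neighbour-n-false⇒n-true aik nk≡0))

    F-n-away-from-ID∖IN : ∀ {i} → i ∉ IN → (∀ k → Adj G i k → k ∈ ID → k ∈ IN) →
                          F G y (inj₁ i) ≡ x (inj₁ i)
    F-n-away-from-ID∖IN {i} i∉IN ID-nbrs⊆IN =
      trans (F-n-cong G {y} {y₀} agree) (inv₀ y₀ (project-Subspace x I₀? y) (inj₁ i) i∉IN)
      where
      I₀? : Decidable (combine IN IN)
      I₀? = combine? IN IN
      y₀ : State L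
      y₀ = project x I₀? y
      agree : ∀ k → Adj G i k → y (inj₂ k) ≡ y₀ (inj₂ k)
      agree k aik with k ∈? IN
      ... | yes _    = refl
      ... | no k∉IN  = y∈ (inj₂ k) (λ k∈ID → k∉IN (ID-nbrs⊆IN k aik k∈ID))

  invariant-ID : F-Invariant G x (combine IN ID)
  invariant-ID y y∈ (inj₂ i) i∉ID =
    d-Invariant {I = combine IN ID} y i (λ i∈IN → i∉ID (IN⊆ID i i∈IN)) y∈
  invariant-ID y y∈ (inj₁ i) i∉IN
    with any? (λ j → (adj G i j ≟ᵇ true) ×-dec (j ∈? ID) ×-dec ¬? (j ∈? IN))
  ... | yes (j , aij , j∈ID , j∉IN) = F-n-near-ID∖IN y∈ aij j∈ID j∉IN
  ... | no none = F-n-away-from-ID∖IN y∈ i∉IN ID-nbrs⊆IN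
    where
    ID-nbrs⊆IN : ∀ k → Adj G i k → k ∈ ID → k ∈ IN
    ID-nbrs⊆IN k aik k∈ID with k ∈? IN
    ... | yes k∈IN = k∈IN
    ... | no k∉IN  = ⊥-elim (none (k , aik , k∈ID , k∉IN))

theorem8 : (L : ℕ) → L ≥ 1 → (G : Graph L) → (x : State L) → FixedPoint G x →
    (IN ID : Subset L) →
    TrapSpace G x (combine IN ID) ⇔
      (TrapSpace G x (combine IN IN)
       × (∀ i → i ∈ IN → i ∈ ID)
       × (∀ j → j ∈ ID → j ∉ IN →
            (∀ i → Adj G j i → i ∉ ID) × x (inj₁ j) ≡ false)
       × (∀ i → InS G (λ j → j ∈ ID × j ∉ IN) i →
            ∃[ k ] (Adj G i k × k ∉ ID × x (inj₁ k) ≡ false)))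
theorem8 L _ G x fp IN ID = mk⇔
  (λ T → let open Forward G fp IN ID (to (trap⇔ _) T) in
     from (trap⇔ _) invariant-IN , IN⊆ID
     , (λ j j∈ID j∉IN → ID∖IN-isolated j∈ID j∉IN , ID∖IN-n-false j∈ID j∉IN)
     , escape-ID∖IN)
  (λ (T₀ , IN⊆ID , _ , escape) →
     from (trap⇔ _) (Backward.invariant-ID G fp IN ID (to (trap⇔ _) T₀) IN⊆ID escape))
  where
  open Equivalence
  trap⇔ : ∀ I → TrapSpace G x I ⇔ F-Invariant G x I
  trap⇔ = trapSpace⇔F-Invariant G x
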